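{- Let $G$ be a graph embedded on an orientable surface without boundary such that every face is homeomorphic to an open disc and every edge lies on the boundary of two distinct faces, let $\alpha$ be strongly connected, and let $D,D'$ be two homologous $\alpha$-orientations of $G$. Fix $F_0\in\mathcal F$. Then the function $z_{D'-D}:\mathcal F\to\mathbb Z$ described below is well defined, and $$\phi(D'-D)=\sum_{F\in\mathcal F}z_{D'-D}(F)\,\phi(F).$$
   Context: Under the embedding assumptions, each face is bounded by a circuit (facial circuit), every edge lies on exactly two distinct facial circuits, and $\mathcal F$ denotes the set of facial circuits. For $\alpha:V(G)\to\mathbb Z_{\ge 0}$, an $\alpha$-orientation is an orientation $D$ of $G$ in which every vertex $v$ has out-degree $\alpha(v)$; $\alpha$ is strongly connected if (some, equivalently every) $\alpha$-orientation is strongly connected. Fix an orientation $D_0$ of $G$ with edge set $E$; for an oriented subgraph $D$, $\phi(D)\in\mathbb Z^E$ has coordinate $1$ at $e$ if $e\in D$ with the same direction as in $D_0$, $-1$ if $e\in D$ with the opposite direction, $0$ if $e\notin D$. Each $F\in\mathcal F$ is oriented counterclockwise (its face lies to the left when traversing it along its direction) when forming $\phi(F)$. For $\alpha$-orientations $D,D'$, $D'-D$ is the oriented subgraph of $D'$ consisting of the edges whose direction in $D'$ differs from that in $D$ (with their direction in $D'$). $D$ and $D'$ are homologous if $\phi(D'-D)=\sum_{F\in\mathcal F}\lambda_F\phi(F)$ for some integers $\lambda_F$. The function $z_{D'-D}$ is defined by: $z_{D'-D}(F_0)=0$, and whenever facial circuits $F,F'$ share an edge $e$: $z_{D'-D}(F)=z_{D'-D}(F')+1$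 if $e\in D'-D$ and $F$ lies to the left of $e$ (when traversing $e$ along its direction in $D'-D$); $z_{D'-D}(F)=z_{D'-D}(F')-1$ if $e\in D'-D$ and $F'$ lies to the left of $e$; $z_{D'-D}(F)=z_{D'-D}(F')$ if $e\notin D'-D$. "Well defined" means these rules determine a unique consistent function on $\mathcal F$. -}

module Defs where

open import Data.Nat using (ℕ; zero; suc)
open import Data.Fin using (Fin; zero; suc)
open import Data.Fin.Properties using () renaming (_≟_ to _≟ᶠ_)
open import Data.Bool using (Bool; true; false; not)
open import Data.Bool.Properties using () renaming (_≟_ to _≟ᵇ_)
open import Data.Integer using (ℤ; +_; -_; _+_; _*_)
open import Data.Product using (Σ; ∃; _×_; _,_)
open import Relation.Nullary using (¬_; yes; no; does)
open import Relation.Binary.PropositionalEquality using (_≡_; _≢_)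

iter : ∀ {A : Set} → ℕ → (A → A) → A → A
iter zero    f x = x
iter (suc k) f x = f (iter k f x)

sumℤ : ∀ {k} → (Fin k → ℤ) → ℤ
sumℤ {zero}  g = + 0
sumℤ {suc k} g = g zero + sumℤ (λ i → g (suc i))

count : ∀ {k} → (Fin k → Bool) → ℕ
count {zero}  p = 0
count {suc k} p with p zero
... | true  = suc (count (λ i → p (suc i)))
... | false = count (λ i → p (suc i))

-- Combinatorial maps (rotation systems) = cellularly embedded graphs on
-- closed orientable surfaces.
--
-- Edges are Fin m; each edge e has two darts (half-edges) (e , true) and
-- (e , false).  The reference orientation D₀ directs e from the vertex of
-- the dart (e , true) to the vertex of the dart (e , false).
-- θ is the dart involution (e , b) ↦ (e , not b); σ is the rotation
-- (permutation of darts) whose orbits are the vertices, listed clockwise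
-- around each vertex w.r.t. a fixed orientation of the surface.
-- Faces are the orbits of σ ∘ θ; the face containing a dart d is the face
-- lying to the LEFT of d when d is traversed from its vertex along its edge,
-- and the σ∘θ-orbit of d is the counterclockwise boundary walk of that face.

Dart : ℕ → Set
Dart m = Fin m × Bool

θ : ∀ {m} → Dart m → Dart m
θ (e , b) = e , not b

data MapReach {m} (σ : Dart m → Dart m) : Dart m → Dart m → Set where
  here  : ∀ {d} → MapReach σ d d
  viaσ  : ∀ {d d'} → MapReach σ d d' → MapReach σ d (σ d')
  viaθ  : ∀ {d d'} → MapReach σ d d' → MapReach σ d (θ d')

record EmbeddedGraph (n m f : ℕ) : Set where
  field
    σ        : Dart m → Dart m
    σ⁻¹      : Dart m → Dart m
    σσ⁻¹     : ∀ d → σ (σ⁻¹ d) ≡ d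
    σ⁻¹σ     : ∀ d → σ⁻¹ (σ d) ≡ d
    vertexOf    : Dart m → Fin n
    vertexOf-orbit : ∀ d d' → (vertexOf d ≡ vertexOf d') → ∃ λ k → iter k σ d ≡ d'
    orbit-vertexOf : ∀ d k → vertexOf (iter k σ d) ≡ vertexOf d
    vertexOf-onto  : ∀ v → ∃ λ d → vertexOf d ≡ v
    -- faces are exactly the (σ ∘ θ)-orbits (faces are open discs)
    faceOf      : Dart m → Fin f
    faceOf-orbit : ∀ d d' → (faceOf d ≡ faceOf d') → ∃ λ k → iter k (λ x → σ (θ x)) d ≡ d'
    orbit-faceOf : ∀ d k → faceOf (iter k (λ x → σ (θ x)) d) ≡ faceOf d
    faceOf-onto  : ∀ F → ∃ λ d → faceOf d ≡ F
    connected : ∀ d d' → MapReach σ d d'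
    -- every face is bounded by a circuit: its boundary walk repeats no vertex
    facial-circuit : ∀ d d' → faceOf d ≡ faceOf d' → vertexOf d ≡ vertexOf d' → d ≡ d'
    two-faces : ∀ e → faceOf (e , true) ≢ faceOf (e , false)

module _ {n m f : ℕ} (G : EmbeddedGraph n m f) where
  open EmbeddedGraph G

  -- An orientation: D e = true iff e is directed as in D₀.
  Orientation : Set
  Orientation = Fin m → Bool

  tail : Orientation → Fin m → Fin n
  tail D e = vertexOf (e , D e)

  head : Orientation → Fin m → Fin n
  head D e = vertexOf (e , not (D e))

  outdeg : Orientation → Fin n → ℕ
  outdeg D v = count (λ e → does (tail D e ≟ᶠ v))

  IsαOrientation : (Fin n → ℕ) → Orientation → Set
  IsαOrientation α D = ∀ v → outdeg D v ≡ α v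

  data Reach (D : Orientation) : Fin n → Fin n → Set where
    refl-r : ∀ {u} → Reach D u u
    step   : ∀ {u} e → Reach D u (tail D e) → Reach D u (head D e)

  StronglyConnected : Orientation → Set
  StronglyConnected D = ∀ u v → Reach D u v

  StronglyConnectedα : (Fin n → ℕ) → Set
  StronglyConnectedα α = ∀ D → IsαOrientation α D → StronglyConnected D

  φDiff : Orientation → Orientation → Fin m → ℤ
  φDiff D D' e with D e ≟ᵇ D' e
  ... | yes _ = + 0
  ... | no  _ with D' e
  ...   | true  = + 1
  ...   | false = - (+ 1)

  -- φ(F) for the counterclockwise facial circuit F
  φFace : Fin f → Fin m → ℤ
  φFace F e with faceOf (e , true) ≟ᶠ F
  ... | yes _ = + 1
  ... | no  _ with faceOf (e , false) ≟ᶠ F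
  ...   | yes _ = - (+ 1)
  ...   | no  _ = + 0

  Homologous : Orientation → Orientation → Set
  Homologous D D' = Σ (Fin f → ℤ) λ λ' →
    ∀ e → φDiff D D' e ≡ sumℤ (λ F → λ' F * φFace F e)

  -- For an edge e the face
  -- to the left of e traversed along its direction in D' is faceOf (e , D' e),
  -- the one to the right is faceOf (e , not (D' e)).
  ZRules : Orientation → Orientation → Fin f → (Fin f → ℤ) → Set
  ZRules D D' F₀ z =
    (z F₀ ≡ + 0) ×
    (∀ e → D e ≢ D' e → z (faceOf (e , D' e)) ≡ z (faceOf (e , not (D' e))) + + 1) ×
    (∀ e → D e ≡ D' e → z (faceOf (e , D' e)) ≡ z (faceOf (e , not (D' e))))

-- Homology provides λ with φ(D' − D) = Σ_F λ_F φ(F).  Every edge e lies on exactly two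
-- faces, with opposite signs, so the e-coordinate of Σ_F z_F φ(F) is the coboundary
-- z(left of e) − z(right of e) (sides taken along D₀).  Comparing with φ(D' − D) edge by
-- edge, the rules defining z_{D'−D} say precisely that z vanishes at F₀ and has coboundary
-- φ(D' − D).  Hence z = λ − λ(F₀) satisfies them, and any two solutions coincide because a
-- function on faces with zero coboundary is constant on the connected surface.
module Submission where

open import Defs
open import Data.Nat as ℕ using (ℕ)
open import Data.Fin using (Fin; zero; suc)
open import Data.Fin.Properties using () renaming (_≟_ to _≟ᶠ_)
open import Data.Bool using (Bool; true; false; not)
open import Data.Bool.Properties using (not-involutive) renaming (_≟_ to _≟ᵇ_)
open import Data.Integer using (ℤ; +_; -_; _+_; _-_; _*_)
open import Data.Integer.Properties using (+-identityˡ; +-identityʳ; +-inverseʳ; *-zeroʳ; neg-involutive; i-j≡0⇒i≡j)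
open import Data.Integer.Tactic.RingSolver using (solve-∀)
open import Data.Product using (Σ; _×_; _,_; proj₁; proj₂)
open import Data.Empty using (⊥-elim)
open import Function.Bundles using (_⇔_; mk⇔; Equivalence)
open import Relation.Nullary using (yes; no)
open import Relation.Binary.PropositionalEquality
  using (_≡_; _≢_; _≗_; refl; sym; trans; cong; cong₂; subst; module ≡-Reasoning)

open Equivalence using (to; from)

i-j≡k⇔i≡j+k : ∀ i j k → i - j ≡ k ⇔ i ≡ j + k
i-j≡k⇔i≡j+k i j k = mk⇔
  (λ p → trans (i≡j+[i-j] i j) (cong (λ x → j + x) p))
  (λ p → trans (cong (_- j) p) ([j+k]-j≡k j k))
  where
  i≡j+[i-j] : ∀ i j → i ≡ j + (i - j)
  i≡j+[i-j] = solve-∀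
  [j+k]-j≡k : ∀ j k → (j + k) - j ≡ k
  [j+k]-j≡k = solve-∀

i-j≡-k⇔j≡i+k : ∀ i j k → i - j ≡ - k ⇔ j ≡ i + k
i-j≡-k⇔j≡i+k i j k = mk⇔
  (λ p → trans (j≡i+-[i-j] i j) (trans (cong (λ x → i + - x) p) (cong (λ x → i + x) (neg-involutive k))))
  (λ p → trans (cong (λ x → i - x) p) (i-[i+k]≡-k i k))
  where
  j≡i+-[i-j] : ∀ i j → j ≡ i + - (i - j)
  j≡i+-[i-j] = solve-∀
  i-[i+k]≡-k : ∀ i k → i - (i + k) ≡ - k
  i-[i+k]≡-k = solve-∀

signed : Bool → ℤ → ℤ
signed true  k = k
signed false k = - k

difference≡signed⇔ : (h : Bool → ℤ) (b : Bool) (k : ℤ) →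
  h true - h false ≡ signed b k ⇔ h b ≡ h (not b) + k
difference≡signed⇔ h true  k = i-j≡k⇔i≡j+k (h true) (h false) k
difference≡signed⇔ h false k = i-j≡-k⇔j≡i+k (h true) (h false) k

sumℤ-cong : ∀ {k} {u v : Fin k → ℤ} → u ≗ v → sumℤ u ≡ sumℤ v
sumℤ-cong {ℕ.zero}  u≗v = refl
sumℤ-cong {ℕ.suc k} u≗v = cong₂ _+_ (u≗v zero) (sumℤ-cong (λ i → u≗v (suc i)))

sumℤ-0 : ∀ k → sumℤ {k} (λ _ → + 0) ≡ + 0
sumℤ-0 ℕ.zero    = refl
sumℤ-0 (ℕ.suc k) = trans (+-identityˡ _) (sumℤ-0 k)

sumℤ-distrib-- : ∀ {k} (u v : Fin k → ℤ) → sumℤ (λ i → u i - v i) ≡ sumℤ u - sumℤ v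
sumℤ-distrib-- {ℕ.zero}  u v = refl
sumℤ-distrib-- {ℕ.suc k} u v =
  trans (cong (λ x → (u zero - v zero) + x) (sumℤ-distrib-- (λ i → u (suc i)) (λ i → v (suc i))))
        (interchange (u zero) (v zero) _ _)
  where
  interchange : ∀ a b c d → (a - b) + (c - d) ≡ (a + c) - (b + d)
  interchange = solve-∀

δ : ∀ {k} → Fin k → Fin k → ℤ
δ zero    zero    = + 1
δ zero    (suc _) = + 0
δ (suc _) zero    = + 0
δ (suc a) (suc i) = δ a i

δ-refl : ∀ {k} (a : Fin k) → δ a a ≡ + 1
δ-refl zero    = refl
δ-refl (suc a) = δ-refl a

δ-≢ : ∀ {k} {a i : Fin k} → a ≢ i → δ a i ≡ + 0
δ-≢ {a = zero}  {zero}  a≢i = ⊥-elim (a≢i refl)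
δ-≢ {a = zero}  {suc i} a≢i = refl
δ-≢ {a = suc a} {zero}  a≢i = refl
δ-≢ {a = suc a} {suc i} a≢i = δ-≢ (λ a≡i → a≢i (cong suc a≡i))

sumℤ-*-δ : ∀ {k} (g : Fin k → ℤ) (a : Fin k) → sumℤ (λ i → g i * δ a i) ≡ g a
sumℤ-*-δ {ℕ.suc k} g zero = begin
  g zero * + 1 + sumℤ (λ i → g (suc i) * + 0)
    ≡⟨ cong (λ x → g zero * + 1 + x) (sumℤ-cong (λ i → *-zeroʳ (g (suc i)))) ⟩
  g zero * + 1 + sumℤ {k} (λ _ → + 0)
    ≡⟨ cong (λ x → g zero * + 1 + x) (sumℤ-0 k) ⟩
  g zero * + 1 + + 0
    ≡⟨ x*1+0≡x (g zero) ⟩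
  g zero
    ∎
  where
  open ≡-Reasoning
  x*1+0≡x : ∀ x → x * + 1 + + 0 ≡ x
  x*1+0≡x = solve-∀
sumℤ-*-δ {ℕ.suc k} g (suc a) =
  trans (cong (_+ sumℤ (λ i → g (suc i) * δ a i)) (*-zeroʳ (g zero)))
        (trans (+-identityˡ _) (sumℤ-*-δ (λ i → g (suc i)) a))

module _ {n m f : ℕ} (G : EmbeddedGraph n m f) where
  open EmbeddedGraph G

  coboundary : (Fin f → ℤ) → Fin m → ℤ
  coboundary z e = z (faceOf (e , true)) - z (faceOf (e , false))

  coboundary-shift : ∀ (z : Fin f → ℤ) c e → coboundary (λ F → z F - c) e ≡ coboundary z e
  coboundary-shift z c e = [a-c]-[b-c]≡a-b (z (faceOf (e , true))) (z (faceOf (e , false))) c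
    where
    [a-c]-[b-c]≡a-b : ∀ a b c → (a - c) - (b - c) ≡ a - b
    [a-c]-[b-c]≡a-b = solve-∀

  φFace≡δ-δ : ∀ F e → φFace G F e ≡ δ (faceOf (e , true)) F - δ (faceOf (e , false)) F
  φFace≡δ-δ F e with faceOf (e , true) ≟ᶠ F
  ... | yes refl = sym (cong₂ _-_ (δ-refl F) (δ-≢ (λ q → two-faces e (sym q))))
  ... | no ≢F with faceOf (e , false) ≟ᶠ F
  ...   | yes refl = sym (cong₂ _-_ (δ-≢ ≢F) (δ-refl (faceOf (e , false))))
  ...   | no ≢F'   = sym (cong₂ _-_ (δ-≢ ≢F) (δ-≢ ≢F'))

  sumℤ-*-φFace : ∀ (z : Fin f → ℤ) e → sumℤ (λ F → z F * φFace G F e) ≡ coboundary z e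
  sumℤ-*-φFace z e = begin
    sumℤ (λ F → z F * φFace G F e)
      ≡⟨ sumℤ-cong (λ F → trans (cong (z F *_) (φFace≡δ-δ F e)) (*-distribˡ-- (z F) _ _)) ⟩
    sumℤ (λ F → z F * δ (faceOf (e , true)) F - z F * δ (faceOf (e , false)) F)
      ≡⟨ sumℤ-distrib-- (λ F → z F * δ (faceOf (e , true)) F) (λ F → z F * δ (faceOf (e , false)) F) ⟩
    sumℤ (λ F → z F * δ (faceOf (e , true)) F) - sumℤ (λ F → z F * δ (faceOf (e , false)) F)
      ≡⟨ cong₂ _-_ (sumℤ-*-δ z _) (sumℤ-*-δ z _) ⟩
    coboundary z e
      ∎
    where
    open ≡-Reasoning
    *-distribˡ-- : ∀ x a b → x * (a - b) ≡ x * a - x * b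
    *-distribˡ-- = solve-∀

  faceOf-σ : ∀ d → faceOf (σ d) ≡ faceOf (θ d)
  faceOf-σ (e , b) = subst (λ x → faceOf (σ (e , x)) ≡ faceOf (e , not b)) (not-involutive b)
                           (orbit-faceOf (e , not b) 1)

  edge-invariant⇒constant : ∀ {a} {A : Set a} (w : Fin f → A) →
    (∀ e → w (faceOf (e , true)) ≡ w (faceOf (e , false))) → ∀ F F' → w F ≡ w F'
  edge-invariant⇒constant w invariant F F'
    with faceOf-onto F | faceOf-onto F'
  ... | d , refl | d' , refl = along (connected d d')
    where
    across : ∀ d → w (faceOf d) ≡ w (faceOf (θ d))
    across (e , true)  = invariant e
    across (e , false) = sym (invariant e)

    along : ∀ {d'} → MapReach σ d d' → w (faceOf d) ≡ w (faceOf d')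
    along here              = refl
    along (viaσ {d' = x} r) = trans (along r) (trans (across x) (sym (cong w (faceOf-σ x))))
    along (viaθ {d' = x} r) = trans (along r) (across x)

  coboundary-injective : ∀ (F₀ : Fin f) (z z' : Fin f → ℤ) →
    z F₀ ≡ z' F₀ → coboundary z ≗ coboundary z' → z ≗ z'
  coboundary-injective F₀ z z' agree same-coboundary F =
    i-j≡0⇒i≡j (z F) (z' F) (begin
      z F - z' F    ≡⟨ edge-invariant⇒constant (λ F → z F - z' F) invariant F F₀ ⟩
      z F₀ - z' F₀  ≡⟨ cong (_- z' F₀) agree ⟩
      z' F₀ - z' F₀ ≡⟨ +-inverseʳ (z' F₀) ⟩
      + 0           ∎)
    where
    open ≡-Reasoning
    exchange : ∀ a b c d → a - b ≡ c - d → a - c ≡ b - d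
    exchange a b c d p = begin
      a - c                       ≡⟨ rearrange a b c d ⟩
      (a - b) - (c - d) + (b - d) ≡⟨ cong (λ x → x - (c - d) + (b - d)) p ⟩
      (c - d) - (c - d) + (b - d) ≡⟨ cong (_+ (b - d)) (+-inverseʳ (c - d)) ⟩
      + 0 + (b - d)               ≡⟨ +-identityˡ (b - d) ⟩
      b - d                       ∎
      where
      rearrange : ∀ a b c d → a - c ≡ (a - b) - (c - d) + (b - d)
      rearrange = solve-∀
    invariant : ∀ e → z (faceOf (e , true)) - z' (faceOf (e , true))
                    ≡ z (faceOf (e , false)) - z' (faceOf (e , false))
    invariant e = exchange (z (faceOf (e , true))) (z (faceOf (e , false)))
                           (z' (faceOf (e , true))) (z' (faceOf (e , false))) (same-coboundary e)

module _ {n m f : ℕ} (G : EmbeddedGraph n m f) (D D' : Orientation G) where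
  open EmbeddedGraph G

  jump : Fin m → ℤ
  jump e with D e ≟ᵇ D' e
  ... | yes _ = + 0
  ... | no  _ = + 1

  φDiff≡signed-jump : ∀ e → φDiff G D D' e ≡ signed (D' e) (jump e)
  φDiff≡signed-jump e with D e ≟ᵇ D' e
  ... | yes _ = sym (signed-0 (D' e))
    where
    signed-0 : ∀ b → signed b (+ 0) ≡ + 0
    signed-0 true  = refl
    signed-0 false = refl
  ... | no _ with D' e
  ...   | true  = refl
  ...   | false = refl

  JumpRule : (Fin f → ℤ) → Fin m → Set
  JumpRule z e = z (faceOf (e , D' e)) ≡ z (faceOf (e , not (D' e))) + jump e

  EdgeRules : (Fin f → ℤ) → Fin m → Set
  EdgeRules z e =
    (D e ≢ D' e → z (faceOf (e , D' e)) ≡ z (faceOf (e , not (D' e))) + + 1) ×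
    (D e ≡ D' e → z (faceOf (e , D' e)) ≡ z (faceOf (e , not (D' e))))

  EdgeRules⇔JumpRule : ∀ z e → EdgeRules z e ⇔ JumpRule z e
  EdgeRules⇔JumpRule z e with D e ≟ᵇ D' e
  ... | yes same = mk⇔
    (λ (_ , same-rule) → trans (same-rule same) (sym (+-identityʳ _)))
    (λ rule → (λ differ → ⊥-elim (differ same)) , (λ _ → trans rule (+-identityʳ _)))
  ... | no differ = mk⇔
    (λ (differ-rule , _) → differ-rule differ)
    (λ rule → (λ _ → rule) , (λ same → ⊥-elim (differ same)))

  coboundary≡φDiff⇔JumpRule : ∀ z e → coboundary G z e ≡ φDiff G D D' e ⇔ JumpRule z e
  coboundary≡φDiff⇔JumpRule z e = mk⇔
    (λ p → to signed-form (trans p (φDiff≡signed-jump e)))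
    (λ rule → trans (from signed-form rule) (sym (φDiff≡signed-jump e)))
    where
    signed-form : coboundary G z e ≡ signed (D' e) (jump e) ⇔ JumpRule z e
    signed-form = difference≡signed⇔ (λ b → z (faceOf (e , b))) (D' e) (jump e)

  ZRules⇔coboundary≡φDiff : ∀ F₀ z →
    ZRules G D D' F₀ z ⇔ (z F₀ ≡ + 0 × coboundary G z ≗ φDiff G D D')
  ZRules⇔coboundary≡φDiff F₀ z = mk⇔
    (λ (z₀ , differ-rule , same-rule) → z₀ , λ e →
      from (coboundary≡φDiff⇔JumpRule z e) (to (EdgeRules⇔JumpRule z e) (differ-rule e , same-rule e)))
    (λ (z₀ , cob) → z₀ , (λ e → proj₁ (rules cob e)) , (λ e → proj₂ (rules cob e)))
    where
    rules : coboundary G z ≗ φDiff G D D' → ∀ e → EdgeRules z e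
    rules cob e = from (EdgeRules⇔JumpRule z e) (to (coboundary≡φDiff⇔JumpRule z e) (cob e))

proposition3p2 : {n m f : ℕ} (G : EmbeddedGraph n m f) (α : Fin n → ℕ)
    → StronglyConnectedα G α
    → (D D' : Orientation G) → IsαOrientation G α D → IsαOrientation G α D'
    → Homologous G D D'
    → (F₀ : Fin f)
    → Σ (Fin f → ℤ) λ z →
        ZRules G D D' F₀ z
        × (∀ z' → ZRules G D D' F₀ z' → ∀ F → z' F ≡ z F)
        × (∀ e → φDiff G D D' e ≡ sumℤ (λ F → z F * φFace G F e))
proposition3p2 {f = f} G α _ D D' _ _ (λ' , homology) F₀ = z , rules , unique , decomposition
  where
  z : Fin f → ℤ
  z F = λ' F - λ' F₀

  coboundary-z : coboundary G z ≗ φDiff G D D'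
  coboundary-z e = trans (coboundary-shift G λ' (λ' F₀) e)
                         (trans (sym (sumℤ-*-φFace G λ' e)) (sym (homology e)))

  rules : ZRules G D D' F₀ z
  rules = from (ZRules⇔coboundary≡φDiff G D D' F₀ z) (+-inverseʳ (λ' F₀) , coboundary-z)

  unique : ∀ z' → ZRules G D D' F₀ z' → ∀ F → z' F ≡ z F
  unique z' rules' =
    let z'₀ , coboundary-z' = to (ZRules⇔coboundary≡φDiff G D D' F₀ z') rules'
    in  coboundary-injective G F₀ z' z (trans z'₀ (sym (+-inverseʳ (λ' F₀))))
          (λ e → trans (coboundary-z' e) (sym (coboundary-z e)))

  decomposition : ∀ e → φDiff G D D' e ≡ sumℤ (λ F → z F * φFace G F e)
  decomposition e = trans (sym (coboundary-z e)) (sym (sumℤ-*-φFace G z e))
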